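{- Let $\mathcal{T}^{r}(n,k)$ be the set of Trees of Ordered Partitions for a set $Q$ of $n$ states with $\mu=\min(n,k)$. Then $|\mathcal{T}^{r}(n,k)|=2^{O(n\lg n)}$.
   Context: A Tree of Ordered Partitions (for $Q$, $|Q|=n$, and $\mu=\min(n,k)$) is a finite rooted ordered tree (children of each node are linearly ordered) whose nodes are labeled by subsets of $Q$, such that: the root is labeled $Q$; for every internal node, the labels of its children are pairwise disjoint (possibly empty) sets whose union is the label of that node, and nodes labeled $\emptyset$ are leaves; the height (length of the longest root-to-leaf path) is at most $\mu$; and the tree has at most $n$ leaves. -}

module Defs where

open import Data.Nat using (ℕ; zero; suc; _≤_; _⊔_; _⊓_; _+_)
open import Data.List using (List; []; _∷_; map)
open import Data.List.Relation.Unary.AllPairs using (AllPairs)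
open import Data.Fin.Subset using (Subset; _∩_; ⋃; Nonempty; Empty; ⊤)
open import Data.Product using (_×_)
open import Data.Unit using () renaming (⊤ to Unit)
open import Relation.Binary.PropositionalEquality using (_≡_)

data Tree (n : ℕ) : Set where
  node : Subset n → List (Tree n) → Tree n

label : ∀ {n} → Tree n → Subset n
label (node p _) = p

Disjoint : ∀ {n} → Subset n → Subset n → Set
Disjoint p q = Empty (p ∩ q)

mutual
  height : ∀ {n} → Tree n → ℕ
  height (node _ []) = 0
  height (node _ (t ∷ ts)) = suc (heights (t ∷ ts))

  heights : ∀ {n} → List (Tree n) → ℕ
  heights [] = 0
  heights (t ∷ ts) = height t ⊔ heights ts

mutual
  leaves : ∀ {n} → Tree n → ℕ
  leaves (node _ []) = 1
  leaves (node _ (t ∷ ts)) = leavesL (t ∷ ts)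

  leavesL : ∀ {n} → List (Tree n) → ℕ
  leavesL [] = 0
  leavesL (t ∷ ts) = leaves t + leavesL ts

mutual
  NodesOK : ∀ {n} → Tree n → Set
  NodesOK (node p []) = Unit
  NodesOK (node p (t ∷ ts)) =
    Nonempty p × AllPairs Disjoint (map label (t ∷ ts))
    × ⋃ (map label (t ∷ ts)) ≡ p × AllNodesOK (t ∷ ts)

  AllNodesOK : ∀ {n} → List (Tree n) → Set
  AllNodesOK [] = Unit
  AllNodesOK (t ∷ ts) = NodesOK t × AllNodesOK ts

IsTOP : (n k : ℕ) → Tree n → Set
IsTOP n k t = label t ≡ ⊤ × NodesOK t × height t ≤ n ⊓ k × leaves t ≤ n

-- A TOP is determined by two pieces of data, each consisting of O(n) numbers
-- in {0, …, n}. The first is its shape with labels erased: after collapsing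
-- every chain of unary nodes into its length, a tree with at most n leaves
-- has fewer than n branching nodes, so a preorder listing of the pairs
-- (chain length, number of children) takes at most 4n numbers, each bounded
-- by the height or by the number of leaves, hence by n. The second is, for
-- every state, the position of the unique leaf containing it: since children
-- partition their parent and the root is Q, the label of each node is the
-- set of states whose leaf lies among the leaves below that node. Hence there
-- are at most (n+1)^(5n) = 2^(O(n lg n)) TOPs.
module Submission where

open import Defs
open import Data.Nat using (ℕ; _≤_; _*_; _^_)
open import Data.Nat.Logarithm using (⌊log₂_⌋)
open import Data.List using (List; length)
open import Data.List.Membership.Propositional using (_∈_)
open import Data.Product using (_×_; ∃-syntax)

open import Data.Nat using (zero; suc; _+_; _∸_; _<_; z≤n; s≤s; _≤?_; _<?_)
open import Data.Nat.Properties
open import Data.Nat.Logarithm using (⌊log₂⌋-mono-≤; ⌊log₂[2^n]⌋≡n)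
open import Data.Nat.Solver using (module +-*-Solver)
open import Data.Bool using (if_then_else_)
open import Data.Fin as Fin using (Fin; toℕ)
open import Data.Fin.Subset using (Subset; ⋃; ⊤) renaming (_∈_ to _∈ₛ_; _∉_ to _∉ₛ_; ⊥ to ∅)
open import Data.Fin.Subset.Properties using (_∈?_; ∉⊥; ∈⊤; ⊆-antisym; x∈p∩q⁺; x∈p∪q⁺; x∈p∪q⁻)
open import Data.Vec using (tabulate)
open import Data.Vec.Properties using (lookup∘tabulate; lookup⇒[]=; []=⇒lookup)
open import Data.List using ([]; _∷_; _++_; map; replicate; drop; upTo; cartesianProductWith)
  renaming (tabulate to tabulateL)
open import Data.List.Properties using (++-assoc; length-++; length-map; length-replicate; length-tabulate; length-upTo)
open import Data.List.Relation.Unary.All as All using (All; []; _∷_)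
open import Data.List.Relation.Unary.All.Properties using (++⁺; tabulate⁺; replicate⁺)
open import Data.List.Relation.Unary.AllPairs using (AllPairs; []; _∷_)
open import Data.List.Relation.Unary.Any using (here)
open import Data.List.Membership.Propositional.Properties using (∈-map⁺; ∈-upTo⁺; ∈-cartesianProductWith⁺)
open import Data.Product using (_,_; proj₁; proj₂)
open import Data.Sum using (inj₁; inj₂)
open import Data.Empty using (⊥-elim)
open import Function using (_∘_)
open import Relation.Nullary using (Dec; yes; no; does)
open import Relation.Nullary.Decidable using (dec-true; _×-dec_)
open import Relation.Binary.PropositionalEquality using (_≡_; refl; sym; trans; cong; cong₂; subst; module ≡-Reasoning)

private variable
  n B a L : ℕ
  x : Fin n
  p : Subset n

subsetOf : {P : Fin n → Set} → ((y : Fin n) → Dec (P y)) → Subset n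
subsetOf P? = tabulate (λ y → does (P? y))

∈-subsetOf⁺ : {P : Fin n → Set} (P? : (y : Fin n) → Dec (P y)) → P x → x ∈ₛ subsetOf P?
∈-subsetOf⁺ {x = x} P? px = lookup⇒[]= x _ (trans (lookup∘tabulate _ x) (dec-true (P? x) px))

∈-subsetOf⁻ : {P : Fin n → Set} (P? : (y : Fin n) → Dec (P y)) → x ∈ₛ subsetOf P? → P x
∈-subsetOf⁻ {x = x} P? x∈ with P? x | trans (sym (lookup∘tabulate _ x)) ([]=⇒lookup x∈)
... | yes px | _ = px
... | no _   | ()

Disjoint⇒∉⋃ : {qs : List (Subset n)} → All (Disjoint p) qs → x ∈ₛ p → x ∉ₛ ⋃ qs
Disjoint⇒∉⋃ []         _   x∈∅  = ∉⊥ x∈∅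
Disjoint⇒∉⋃ (p#q ∷ ps) x∈p x∈∪ with x∈p∪q⁻ _ _ x∈∪
... | inj₁ x∈q  = p#q (_ , x∈p∩q⁺ (x∈p , x∈q))
... | inj₂ x∈qs = Disjoint⇒∉⋃ ps x∈p x∈qs

-- Leaf indices

-- Leaves are numbered from 0, left to right; states outside the label get the junk value 0.
mutual
  leafIndex : Tree n → Fin n → ℕ
  leafIndex (node _ cs) = leafIndexL cs

  leafIndexL : List (Tree n) → Fin n → ℕ
  leafIndexL []       x = 0
  leafIndexL (c ∷ cs) x = if does (x ∈? label c) then leafIndex c x else leaves c + leafIndexL cs x

leafIndexL-here : (c : Tree n) (cs : List (Tree n)) → x ∈ₛ label c →
                  leafIndexL (c ∷ cs) x ≡ leafIndex c x
leafIndexL-here {x = x} c cs x∈c with x ∈? label c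
... | yes _  = refl
... | no x∉c = ⊥-elim (x∉c x∈c)

leafIndexL-there : (c : Tree n) (cs : List (Tree n)) → x ∉ₛ label c →
                   leafIndexL (c ∷ cs) x ≡ leaves c + leafIndexL cs x
leafIndexL-there {x = x} c cs x∉c with x ∈? label c
... | yes x∈c = ⊥-elim (x∉c x∈c)
... | no _    = refl

mutual
  leafIndex<leaves : (t : Tree n) → NodesOK t → x ∈ₛ label t → leafIndex t x < leaves t
  leafIndex<leaves (node _ [])       _                  _   = s≤s z≤n
  leafIndex<leaves (node _ (c ∷ cs)) (_ , _ , ⋃≡p , oks) x∈p =
    leafIndexL<leavesL (c ∷ cs) oks (subst (_ ∈ₛ_) (sym ⋃≡p) x∈p)

  leafIndexL<leavesL : (cs : List (Tree n)) → AllNodesOK cs → x ∈ₛ ⋃ (map label cs) →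
                       leafIndexL cs x < leavesL cs
  leafIndexL<leavesL []       _          x∈∅ = ⊥-elim (∉⊥ x∈∅)
  leafIndexL<leavesL {x = x} (c ∷ cs) (ok , oks) x∈∪ with x ∈? label c | x∈p∪q⁻ _ _ x∈∪
  ... | yes x∈c | _         = ≤-trans (leafIndex<leaves c ok x∈c) (m≤m+n _ _)
  ... | no x∉c  | inj₁ x∈c  = ⊥-elim (x∉c x∈c)
  ... | no _    | inj₂ x∈cs = +-monoʳ-< (leaves c) (leafIndexL<leavesL cs oks x∈cs)

-- Recovering the labels from the leaf indices

preimage : (Fin n → ℕ) → ℕ → ℕ → Subset n
preimage g a L = subsetOf (λ x → a ≤? g x ×-dec g x <? a + L)

Places : (Fin n → ℕ) → ℕ → Subset n → ℕ → (Fin n → ℕ) → Set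
Places g a p L i = (∀ {x} → x ∈ₛ p → g x ≡ a + i x) × (∀ {x} → a ≤ g x → g x < a + L → x ∈ₛ p)

preimage≡ : ∀ {g i} → Places g a p L i → (∀ {x} → x ∈ₛ p → i x < L) → preimage g a L ≡ p
preimage≡ {a = a} {L = L} {g = g} (sound , complete) i<L = ⊆-antisym
  (λ x∈ → let (lo , hi) = ∈-subsetOf⁻ inInterval? x∈ in complete lo hi)
  (λ x∈p → ∈-subsetOf⁺ inInterval?
     ( subst (a ≤_) (sym (sound x∈p)) (m≤m+n a _)
     , subst (_< a + _) (sym (sound x∈p)) (+-monoʳ-< a (i<L x∈p))))
  where
  inInterval? : ∀ x → Dec (a ≤ g x × g x < a + L)
  inInterval? x = a ≤? g x ×-dec g x <? a + L

Places-∷ : ∀ {g} (c : Tree n) (cs : List (Tree n)) → NodesOK c → All (Disjoint (label c)) (map label cs) →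
           Places g a (⋃ (map label (c ∷ cs))) (leavesL (c ∷ cs)) (leafIndexL (c ∷ cs)) →
           Places g a (label c) (leaves c) (leafIndex c)
           × Places g (a + leaves c) (⋃ (map label cs)) (leavesL cs) (leafIndexL cs)
Places-∷ {a = a} {g = g} c cs ok c#cs (sound , complete) = (soundc , completec) , (soundcs , completecs)
  where
  soundc : ∀ {x} → x ∈ₛ label c → g x ≡ a + leafIndex c x
  soundc x∈c = trans (sound (x∈p∪q⁺ (inj₁ x∈c))) (cong (a +_) (leafIndexL-here c cs x∈c))

  soundcs : ∀ {x} → x ∈ₛ ⋃ (map label cs) → g x ≡ a + leaves c + leafIndexL cs x
  soundcs x∈cs = trans (sound (x∈p∪q⁺ (inj₂ x∈cs)))
    (trans (cong (a +_) (leafIndexL-there c cs (λ x∈c → Disjoint⇒∉⋃ c#cs x∈c x∈cs)))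
           (sym (+-assoc a _ _)))

  completec : ∀ {x} → a ≤ g x → g x < a + leaves c → x ∈ₛ label c
  completec lo hi with x∈p∪q⁻ _ _ (complete lo (<-≤-trans hi (+-monoʳ-≤ a (m≤m+n _ _))))
  ... | inj₁ x∈c  = x∈c
  ... | inj₂ x∈cs = ⊥-elim (<⇒≱ hi (subst (a + leaves c ≤_) (sym (soundcs x∈cs)) (m≤m+n _ _)))

  completecs : ∀ {x} → a + leaves c ≤ g x → g x < a + leaves c + leavesL cs → x ∈ₛ ⋃ (map label cs)
  completecs {x} lo hi with x∈p∪q⁻ _ _ (complete (≤-trans (m≤m+n a _) lo) (subst (g x <_) (+-assoc a (leaves c) _) hi))
  ... | inj₁ x∈c  = ⊥-elim (<⇒≱ (subst (_< a + leaves c) (sym (soundc x∈c))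
                                          (+-monoʳ-< a (leafIndex<leaves c ok x∈c))) lo)
  ... | inj₂ x∈cs = x∈cs

-- The leaves of t are numbered from a.
mutual
  relabel : (Fin n → ℕ) → ℕ → Tree n → Tree n
  relabel g a t@(node _ cs) = node (preimage g a (leaves t)) (relabelL g a cs)

  relabelL : (Fin n → ℕ) → ℕ → List (Tree n) → List (Tree n)
  relabelL g a []       = []
  relabelL g a (c ∷ cs) = relabel g a c ∷ relabelL g (a + leaves c) cs

mutual
  relabel-id : ∀ {g} (t : Tree n) → NodesOK t → Places g a (label t) (leaves t) (leafIndex t) →
               relabel g a t ≡ t
  relabel-id t@(node _ []) ok places = cong (λ q → node q []) (preimage≡ places (leafIndex<leaves t ok))
  relabel-id t@(node _ (c ∷ cs)) ok@(_ , disjoint , ⋃≡p , oks) places =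
    cong₂ node (preimage≡ places (leafIndex<leaves t ok))
               (relabelL-id (c ∷ cs) oks disjoint (subst (λ q → Places _ _ q _ _) (sym ⋃≡p) places))

  relabelL-id : ∀ {g} (cs : List (Tree n)) → AllNodesOK cs → AllPairs Disjoint (map label cs) →
                Places g a (⋃ (map label cs)) (leavesL cs) (leafIndexL cs) → relabelL g a cs ≡ cs
  relabelL-id []       _          _               _      = refl
  relabelL-id (c ∷ cs) (ok , oks) (c#cs ∷ disjoint) places =
    let (placesc , placescs) = Places-∷ c cs ok c#cs places
    in cong₂ _∷_ (relabel-id c ok placesc) (relabelL-id cs oks disjoint placescs)

mutual
  eraseLabels : Tree n → Tree n
  eraseLabels (node _ cs) = node ∅ (eraseLabelsL cs)

  eraseLabelsL : List (Tree n) → List (Tree n)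
  eraseLabelsL []       = []
  eraseLabelsL (c ∷ cs) = eraseLabels c ∷ eraseLabelsL cs

mutual
  leaves-eraseLabels : (t : Tree n) → leaves (eraseLabels t) ≡ leaves t
  leaves-eraseLabels (node _ [])       = refl
  leaves-eraseLabels (node _ (c ∷ cs)) = leavesL-eraseLabelsL (c ∷ cs)

  leavesL-eraseLabelsL : (cs : List (Tree n)) → leavesL (eraseLabelsL cs) ≡ leavesL cs
  leavesL-eraseLabelsL []       = refl
  leavesL-eraseLabelsL (c ∷ cs) = cong₂ _+_ (leaves-eraseLabels c) (leavesL-eraseLabelsL cs)

mutual
  relabel-eraseLabels : ∀ g a (t : Tree n) → relabel g a (eraseLabels t) ≡ relabel g a t
  relabel-eraseLabels g a t@(node _ cs) =
    cong₂ node (cong (preimage g a) (leaves-eraseLabels t)) (relabelL-eraseLabelsL g a cs)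

  relabelL-eraseLabelsL : ∀ g a (cs : List (Tree n)) → relabelL g a (eraseLabelsL cs) ≡ relabelL g a cs
  relabelL-eraseLabelsL g a []       = refl
  relabelL-eraseLabelsL g a (c ∷ cs) rewrite leaves-eraseLabels c =
    cong₂ _∷_ (relabel-eraseLabels g a c) (relabelL-eraseLabelsL g (a + leaves c) cs)

-- Shape codes

chain : ℕ → Tree n → Tree n
chain zero    t = t
chain (suc l) t = chain l (node ∅ (t ∷ []))

-- shapeCode l t encodes chain l t: each maximal chain of unary nodes is
-- collapsed to its length, followed by the number of children of its bottom
-- node (0 for a leaf).
mutual
  shapeCode : ℕ → Tree n → List ℕ
  shapeCode l (node _ [])               = l ∷ 0 ∷ []
  shapeCode l (node _ (c ∷ []))         = shapeCode (suc l) c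
  shapeCode l (node _ cs@(_ ∷ _ ∷ _))   = l ∷ length cs ∷ shapeCodeL cs

  shapeCodeL : List (Tree n) → List ℕ
  shapeCodeL []       = []
  shapeCodeL (c ∷ cs) = shapeCode 0 c ++ shapeCodeL cs

-- The first argument is fuel bounding the depth of the decoded tree.
mutual
  decodeTree : ℕ → List ℕ → Tree n × List ℕ
  decodeTree (suc f) (l ∷ k ∷ xs) = let (cs , rest) = decodeForest f k xs in chain l (node ∅ cs) , rest
  decodeTree _       xs           = node ∅ [] , xs

  decodeForest : ℕ → ℕ → List ℕ → List (Tree n) × List ℕ
  decodeForest f zero    xs = [] , xs
  decodeForest f (suc k) xs =
    let (t , rest)   = decodeTree f xs
        (ts , rest′) = decodeForest f k rest
    in t ∷ ts , rest′

decodeForest-suc : ∀ f k xs {t : Tree n} {r ts r′} → decodeTree f xs ≡ (t , r) →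
                   decodeForest f k r ≡ (ts , r′) → decodeForest f (suc k) xs ≡ (t ∷ ts , r′)
decodeForest-suc f k xs {t} tree≡ forest≡ =
  trans (cong (λ (u , rest) → u ∷ proj₁ (decodeForest f k rest) , proj₂ (decodeForest f k rest)) tree≡)
        (cong (λ (us , rest′) → t ∷ us , rest′) forest≡)

mutual
  decodeTree-shapeCode : ∀ f l (t : Tree n) r → height t < f →
                         decodeTree f (shapeCode l t ++ r) ≡ (chain l (eraseLabels t) , r)
  decodeTree-shapeCode (suc f) l (node _ []) r _ = refl
  decodeTree-shapeCode f l (node _ (c ∷ [])) r h =
    decodeTree-shapeCode f (suc l) c r (<-trans (m⊔n<o⇒m<o (height c) 0 ≤-refl) h)
  decodeTree-shapeCode (suc f) l (node _ cs@(_ ∷ _ ∷ _)) r (s≤s h) =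
    cong (λ (cs′ , rest) → chain l (node ∅ cs′) , rest) (decodeForest-shapeCodeL f cs r h)

  decodeForest-shapeCodeL : ∀ f (cs : List (Tree n)) r → heights cs < f →
                            decodeForest f (length cs) (shapeCodeL cs ++ r) ≡ (eraseLabelsL cs , r)
  decodeForest-shapeCodeL f []       r _ = refl
  decodeForest-shapeCodeL f (c ∷ cs) r h rewrite ++-assoc (shapeCode 0 c) (shapeCodeL cs) r =
    decodeForest-suc f (length cs) _
      (decodeTree-shapeCode f 0 c (shapeCodeL cs ++ r) (m⊔n<o⇒m<o (height c) _ h))
      (decodeForest-shapeCodeL f cs r (m⊔n<o⇒n<o (height c) _ h))

1≤leaves : (t : Tree n) → 1 ≤ leaves t
1≤leaves (node _ [])       = s≤s z≤n
1≤leaves (node _ (c ∷ cs)) = ≤-trans (1≤leaves c) (m≤m+n _ _)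

length≤leavesL : (cs : List (Tree n)) → length cs ≤ leavesL cs
length≤leavesL []       = z≤n
length≤leavesL (c ∷ cs) = +-mono-≤ (1≤leaves c) (length≤leavesL cs)

mutual
  length-shapeCode : ∀ l (t : Tree n) → 2 + length (shapeCode l t) ≤ 4 * leaves t
  length-shapeCode l (node _ [])       = ≤-refl
  length-shapeCode l (node _ (c ∷ [])) rewrite +-identityʳ (leaves c) = length-shapeCode (suc l) c
  length-shapeCode l (node _ cs@(_ ∷ _ ∷ us)) =
    ≤-trans (+-monoˡ-≤ (length (shapeCodeL cs)) (*-monoʳ-≤ 2 (s≤s (s≤s (z≤n {length us})))))
            (length-shapeCodeL cs)

  length-shapeCodeL : (cs : List (Tree n)) → 2 * length cs + length (shapeCodeL cs) ≤ 4 * leavesL cs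
  length-shapeCodeL []       = z≤n
  length-shapeCodeL (c ∷ cs) = begin
    2 * suc (length cs) + length (shapeCode 0 c ++ shapeCodeL cs)
      ≡⟨ cong (2 * suc (length cs) +_) (length-++ (shapeCode 0 c)) ⟩
    2 * suc (length cs) + (length (shapeCode 0 c) + length (shapeCodeL cs))
      ≡⟨ solve 3 (λ k u v → con 2 :* (con 1 :+ k) :+ (u :+ v) := (con 2 :+ u) :+ (con 2 :* k :+ v))
               refl (length cs) (length (shapeCode 0 c)) (length (shapeCodeL cs)) ⟩
    (2 + length (shapeCode 0 c)) + (2 * length cs + length (shapeCodeL cs))
      ≤⟨ +-mono-≤ (length-shapeCode 0 c) (length-shapeCodeL cs) ⟩
    4 * leaves c + 4 * leavesL cs
      ≡⟨ sym (*-distribˡ-+ 4 (leaves c) (leavesL cs)) ⟩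
    4 * leavesL (c ∷ cs) ∎
    where open ≤-Reasoning
          open +-*-Solver using (solve; _:+_; _:*_; con; _:=_)

mutual
  shapeCode-≤ : ∀ {B} l (t : Tree n) → l + height t ≤ B → leaves t ≤ B → All (_≤ B) (shapeCode l t)
  shapeCode-≤ l (node _ []) lh≤B _ = subst (_≤ _) (+-identityʳ l) lh≤B ∷ z≤n ∷ []
  shapeCode-≤ {B = B} l (node _ (c ∷ [])) lh≤B lv≤B =
    shapeCode-≤ (suc l) c
      (subst (_≤ B) (trans (cong (λ h → l + suc h) (⊔-identityʳ (height c))) (+-suc l _)) lh≤B)
      (subst (_≤ _) (+-identityʳ _) lv≤B)
  shapeCode-≤ l (node _ cs@(_ ∷ _ ∷ _)) lh≤B lv≤B =
    ≤-trans (m≤m+n l _) lh≤B ∷ ≤-trans (length≤leavesL cs) lv≤B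
      ∷ shapeCodeL-≤ cs (≤-trans (≤-trans (n≤1+n _) (m≤n+m _ l)) lh≤B) lv≤B

  shapeCodeL-≤ : ∀ {B} (cs : List (Tree n)) → heights cs ≤ B → leavesL cs ≤ B → All (_≤ B) (shapeCodeL cs)
  shapeCodeL-≤ []       _   _   = []
  shapeCodeL-≤ (c ∷ cs) h≤B lv≤B =
    ++⁺ (shapeCode-≤ 0 c (≤-trans (m≤m⊔n _ _) h≤B) (≤-trans (m≤m+n _ _) lv≤B))
        (shapeCodeL-≤ cs (≤-trans (m≤n⊔m (height c) _) h≤B) (≤-trans (m≤n+m _ (leaves c)) lv≤B))

-- Encoding a tree by a list of numbers

at : List ℕ → ℕ → ℕ
at []       _       = 0
at (x ∷ xs) zero    = x
at (x ∷ xs) (suc i) = at xs i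

at-tabulate-++ : (f : Fin n → ℕ) (r : List ℕ) (x : Fin n) → at (tabulateL f ++ r) (toℕ x) ≡ f x
at-tabulate-++ f r Fin.zero    = refl
at-tabulate-++ f r (Fin.suc x) = at-tabulate-++ (f ∘ Fin.suc) r x

drop-tabulate-++ : (f : Fin n → ℕ) (r : List ℕ) → drop n (tabulateL f ++ r) ≡ r
drop-tabulate-++ {zero}  f r = refl
drop-tabulate-++ {suc n} f r = drop-tabulate-++ (f ∘ Fin.suc) r

encode : Tree n → List ℕ
encode {n} t = tabulateL (leafIndex t) ++ shapeCode 0 t ++ replicate (4 * n ∸ length (shapeCode 0 t)) 0

decode : List ℕ → Tree n
decode {n} code = relabel (at code ∘ toℕ) 0 (proj₁ (decodeTree (suc n) (drop n code)))

decode-encode : (t : Tree n) → label t ≡ ⊤ → NodesOK t → height t ≤ n → decode (encode t) ≡ t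
decode-encode {n} t root≡⊤ ok h≤n = begin
  relabel g 0 (proj₁ (decodeTree (suc n) (drop n (encode t))))
    ≡⟨ cong (λ code → relabel g 0 (proj₁ (decodeTree (suc n) code))) (drop-tabulate-++ (leafIndex t) (shapeCode 0 t ++ padding)) ⟩
  relabel g 0 (proj₁ (decodeTree (suc n) (shapeCode 0 t ++ padding)))
    ≡⟨ cong (relabel g 0 ∘ proj₁) (decodeTree-shapeCode (suc n) 0 t padding (s≤s h≤n)) ⟩
  relabel g 0 (eraseLabels t)
    ≡⟨ relabel-eraseLabels g 0 t ⟩
  relabel g 0 t
    ≡⟨ relabel-id t ok ((λ {x} _ → at-tabulate-++ (leafIndex t) _ x) , λ _ _ → subst (_ ∈ₛ_) (sym root≡⊤) ∈⊤) ⟩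
  t ∎
  where
  open ≡-Reasoning
  g = at (encode t) ∘ toℕ
  padding = replicate (4 * n ∸ length (shapeCode 0 t)) 0

length-encode : (t : Tree n) → leaves t ≤ n → length (encode t) ≡ 5 * n
length-encode {n} t lv≤n = begin
  length (tabulateL (leafIndex t) ++ S ++ padding)
    ≡⟨ length-++ (tabulateL (leafIndex t)) ⟩
  length (tabulateL (leafIndex t)) + length (S ++ padding)
    ≡⟨ cong₂ _+_ (length-tabulate (leafIndex t)) (length-++ S) ⟩
  n + (length S + length padding)
    ≡⟨ cong (λ m → n + (length S + m)) (length-replicate (4 * n ∸ length S)) ⟩
  n + (length S + (4 * n ∸ length S))
    ≡⟨ cong (n +_) (m+[n∸m]≡n |S|≤4n) ⟩
  n + 4 * n ∎
  where
  open ≡-Reasoning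
  S = shapeCode 0 t
  padding = replicate (4 * n ∸ length S) 0
  |S|≤4n : length S ≤ 4 * n
  |S|≤4n = ≤-trans (m≤n+m _ 2) (≤-trans (length-shapeCode 0 t) (*-monoʳ-≤ 4 lv≤n))

encode-< : (t : Tree n) → label t ≡ ⊤ → NodesOK t → height t ≤ n → leaves t ≤ n → All (_< suc n) (encode t)
encode-< {n} t root≡⊤ ok h≤n lv≤n =
  ++⁺ (tabulate⁺ {f = leafIndex t} λ x → ≤-trans (leafIndex<leaves t ok (subst (x ∈ₛ_) (sym root≡⊤) ∈⊤)) (m≤n⇒m≤1+n lv≤n))
      (++⁺ (All.map s≤s (shapeCode-≤ 0 t h≤n lv≤n)) (replicate⁺ (4 * n ∸ length (shapeCode 0 t)) (s≤s z≤n)))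

-- Counting

boundedLists : ℕ → ℕ → List (List ℕ)
boundedLists B zero    = [] ∷ []
boundedLists B (suc m) = cartesianProductWith _∷_ (upTo B) (boundedLists B m)

length-cartesianProductWith : ∀ {A C D : Set} (f : A → C → D) xs ys →
                              length (cartesianProductWith f xs ys) ≡ length xs * length ys
length-cartesianProductWith f []       ys = refl
length-cartesianProductWith f (x ∷ xs) ys = begin
  length (map (f x) ys ++ cartesianProductWith f xs ys)
    ≡⟨ length-++ (map (f x) ys) ⟩
  length (map (f x) ys) + length (cartesianProductWith f xs ys)
    ≡⟨ cong₂ _+_ (length-map (f x) ys) (length-cartesianProductWith f xs ys) ⟩
  length ys + length xs * length ys ∎
  where open ≡-Reasoning

length-boundedLists : ∀ B m → length (boundedLists B m) ≡ B ^ m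
length-boundedLists B zero    = refl
length-boundedLists B (suc m) = begin
  length (cartesianProductWith _∷_ (upTo B) (boundedLists B m))
    ≡⟨ length-cartesianProductWith _∷_ (upTo B) (boundedLists B m) ⟩
  length (upTo B) * length (boundedLists B m)
    ≡⟨ cong₂ _*_ (length-upTo B) (length-boundedLists B m) ⟩
  B * B ^ m ∎
  where open ≡-Reasoning

∈-boundedLists : ∀ {m} (xs : List ℕ) → length xs ≡ m → All (_< B) xs → xs ∈ boundedLists B m
∈-boundedLists {m = zero}  []       _       []         = here refl
∈-boundedLists {m = suc m} (x ∷ xs) |xs|≡m (x<B ∷ xs<B) =
  ∈-cartesianProductWith⁺ _∷_ (∈-upTo⁺ x<B) (∈-boundedLists xs (suc-injective |xs|≡m) xs<B)

IsTOP⇒∈decodes : ∀ k (t : Tree n) → IsTOP n k t → t ∈ map decode (boundedLists (suc n) (5 * n))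
IsTOP⇒∈decodes {n} k t (root≡⊤ , ok , h≤n⊓k , lv≤n) =
  subst (_∈ _) (decode-encode t root≡⊤ ok h≤n)
    (∈-map⁺ decode (∈-boundedLists {B = suc n} (encode t) (length-encode t lv≤n) (encode-< t root≡⊤ ok h≤n lv≤n)))
  where
  h≤n : height t ≤ n
  h≤n = ≤-trans h≤n⊓k (m⊓n≤m n k)

n<2^[1+⌊log₂n⌋] : ∀ n → n < 2 ^ suc ⌊log₂ n ⌋
n<2^[1+⌊log₂n⌋] n with n <? 2 ^ suc ⌊log₂ n ⌋
... | yes n<2^ = n<2^
... | no n≮2^  = ⊥-elim (1+n≰n (subst (_≤ ⌊log₂ n ⌋) (⌊log₂[2^n]⌋≡n (suc ⌊log₂ n ⌋)) (⌊log₂⌋-mono-≤ (≮⇒≥ n≮2^))))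

[1+n]^5n≤2^[10n⌊log₂n⌋] : ∀ n → 2 ≤ n → suc n ^ (5 * n) ≤ 2 ^ (10 * n * ⌊log₂ n ⌋)
[1+n]^5n≤2^[10n⌊log₂n⌋] n 2≤n = begin
  suc n ^ (5 * n)
    ≤⟨ ^-monoˡ-≤ (5 * n) (≤-trans (n<2^[1+⌊log₂n⌋] n) (^-monoʳ-≤ 2 (+-monoˡ-≤ ℓ 1≤ℓ))) ⟩
  (2 ^ (ℓ + ℓ)) ^ (5 * n)
    ≡⟨ ^-*-assoc 2 (ℓ + ℓ) (5 * n) ⟩
  2 ^ ((ℓ + ℓ) * (5 * n))
    ≡⟨ cong (2 ^_) (solve 2 (λ l m → (l :+ l) :* (con 5 :* m) := con 10 :* m :* l) refl ℓ n) ⟩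
  2 ^ (10 * n * ℓ) ∎
  where
  open ≤-Reasoning
  open +-*-Solver using (solve; _:+_; _:*_; con; _:=_)
  ℓ = ⌊log₂ n ⌋
  1≤ℓ : 1 ≤ ℓ
  1≤ℓ = ⌊log₂⌋-mono-≤ 2≤n

mainTheorem8 : ∃[ c ] ∃[ N ] ((n k : ℕ) → N ≤ n →
                 ∃[ ts ] ((∀ (t : Tree n) → IsTOP n k t → t ∈ ts)
                          × length ts ≤ 2 ^ (c * n * ⌊log₂ n ⌋)))
mainTheorem8 = 10 , 2 , λ n k 2≤n →
  map decode (boundedLists (suc n) (5 * n)) ,
  IsTOP⇒∈decodes k ,
  (begin
    length (map decode (boundedLists (suc n) (5 * n))) ≡⟨ length-map decode (boundedLists (suc n) (5 * n)) ⟩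
    length (boundedLists (suc n) (5 * n))               ≡⟨ length-boundedLists (suc n) (5 * n) ⟩
    suc n ^ (5 * n)                                     ≤⟨ [1+n]^5n≤2^[10n⌊log₂n⌋] n 2≤n ⟩
    2 ^ (10 * n * ⌊log₂ n ⌋)                             ∎)
  where open ≤-Reasoning
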